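{- Let $H$ be a graph with at least one edge and no isolated edges, and let $k_0,k_1,k_1'$ be as defined in the context. Then in any $H$-saturated graph $G$, the set of vertices of $G$ having no neighbor of degree at least $k_1$ forms a clique, and the set of vertices of $G$ having degree at most $k_0$ and no neighbor of degree at least $k_1'$ also forms a clique.
   Context: Graphs are finite and simple. A graph $G$ is $H$-saturated if $G$ contains no subgraph isomorphic to $H$ but adding any edge joining two nonadjacent vertices of $G$ creates such a subgraph. For an edge $uv$ of $H$, let $N(uv) = (N(u)\setminus\{v\}) \cup (N(v)\setminus\{u\})$; the edge is isolated if $N(uv)=\varnothing$. Degrees in the definitions below are taken in $H$. Define $\mathrm{wt}_0(uv) = \max\{d(u),d(v)\} - 1$ and, for non-isolated $uv$, $\mathrm{wt}_1(uv) = \max_{w \in N(uv)} d(w)$. Let $k_0 = \min_{uv\in E(H)} \mathrm{wt}_0(uv)$, $k_1 = \min_{uv \in E(H)} \mathrm{wt}_1(uv)$, and $k_1' = \min\{\mathrm{wt}_1(uv) : uv \in E(H),\ \mathrm{wt}_0(uv) = k_0\}$. -}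

module Defs where

open import Data.Nat using (ℕ; _≤_; _<_; _≥_; _⊔_; _∸_)
open import Data.Bool using (Bool; true; false; if_then_else_; _∧_; _∨_; not)
open import Data.Fin using (Fin; _≟_)
open import Data.List using (List; map; foldr; allFin)
open import Data.Nat.ListAction using (sum)
open import Data.Product using (Σ; ∃; _×_; _,_)
open import Relation.Binary.PropositionalEquality using (_≡_; _≢_)
open import Relation.Nullary.Decidable using (⌊_⌋)
open import Function.Definitions using (Injective)

record Graph (n : ℕ) : Set where
  field
    adj   : Fin n → Fin n → Bool
    sym   : ∀ i j → adj i j ≡ adj j i
    irref : ∀ i → adj i i ≡ false
open Graph public

deg : ∀ {n} → Graph n → Fin n → ℕ
deg {n} G v = sum (map (λ w → if adj G v w then 1 else 0) (allFin n))

maxFin : ∀ {n} → (Fin n → ℕ) → ℕ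
maxFin {n} f = foldr (λ w acc → f w ⊔ acc) 0 (allFin n)

-- the host "graph" (adjacency relation) A contains a copy of H
-- (not necessarily induced): an injective vertex map preserving edges
ContainsCopy : ∀ {m n} → Graph m → (Fin n → Fin n → Bool) → Set
ContainsCopy {m} {n} H A =
  Σ (Fin m → Fin n) λ f → Injective _≡_ _≡_ f ×
    (∀ i j → adj H i j ≡ true → A (f i) (f j) ≡ true)

addEdge : ∀ {n} → Graph n → Fin n → Fin n → Fin n → Fin n → Bool
addEdge G u v i j =
  adj G i j ∨ ((⌊ i ≟ u ⌋ ∧ ⌊ j ≟ v ⌋) ∨ (⌊ i ≟ v ⌋ ∧ ⌊ j ≟ u ⌋))

Saturated : ∀ {m n} → Graph m → Graph n → Set
Saturated H G =
  (ContainsCopy H (adj G) → Data.Empty.⊥) ×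
  (∀ u v → u ≢ v → adj G u v ≡ false → ContainsCopy H (addEdge G u v))
  where import Data.Empty

IsEdge : ∀ {m} → Graph m → Fin m → Fin m → Set
IsEdge H u v = adj H u v ≡ true

InN : ∀ {m} → Graph m → Fin m → Fin m → Fin m → Bool
InN H u v w = (adj H u w ∧ not ⌊ w ≟ v ⌋) ∨ (adj H v w ∧ not ⌊ w ≟ u ⌋)

IsolatedEdge : ∀ {m} → Graph m → Fin m → Fin m → Set
IsolatedEdge H u v = ∀ w → InN H u v w ≡ false

wt₀ : ∀ {m} → Graph m → Fin m → Fin m → ℕ
wt₀ H u v = (deg H u ⊔ deg H v) ∸ 1

-- wt₁(uv) = max_{w ∈ N(uv)} d(w)   (meaningful for non-isolated uv;
-- vertices outside N(uv) contribute 0, which does not affect the maximum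
-- of a nonempty set of naturals)
wt₁ : ∀ {m} → Graph m → Fin m → Fin m → ℕ
wt₁ H u v = maxFin (λ w → if InN H u v w then deg H w else 0)

IsMinOverEdges : ∀ {m} → Graph m → (Fin m → Fin m → Set) →
                 (Fin m → Fin m → ℕ) → ℕ → Set
IsMinOverEdges H P f k =
  (∃ λ u → ∃ λ v → IsEdge H u v × P u v × f u v ≡ k) ×
  (∀ u v → IsEdge H u v → P u v → k ≤ f u v)

IsClique : ∀ {n} → Graph n → (Fin n → Set) → Set
IsClique G S = ∀ u v → S u → S v → u ≢ v → adj G u v ≡ true

{-# OPTIONS --safe #-}
module Submission where

-- Let u ≠ v be non-adjacent vertices of the set in question. Saturation gives a
-- copy of H in G + uv, and as G itself has no copy, some edge ij of H is sent
-- onto the new edge uv. All other edges of the copy lie in G, so d_H(i) ≤ d_G(u) + 1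
-- and d_H(j) ≤ d_G(v) + 1, i.e. wt₀(ij) ≤ max(d_G(u), d_G(v)); and a vertex of
-- N(ij) of degree wt₁(ij) (it exists since ij is not isolated) is sent to a
-- neighbour of u or v of degree at least wt₁(ij) ≥ k₁. For the second set the
-- degree bound forces wt₀(ij) = k₀, hence wt₁(ij) ≥ k₁′. Either way u or v has a
-- neighbour that is too heavy.

open import Defs
open import Data.Nat using (ℕ; _≤_; _<_)
open import Data.Bool using (true)
open import Data.Fin using (Fin)
open import Data.Product using (∃; _×_)
open import Data.Unit using (⊤)
open import Relation.Binary.PropositionalEquality using (_≡_)
open import Relation.Nullary using (¬_)

open import Data.Bool using (Bool; false; if_then_else_; _∧_; _∨_; not)
open import Data.Bool.Properties as Bool using (∧-identityʳ; ∧-zeroʳ; ∨-comm; ¬-not)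
open import Data.Fin using (zero; suc; _≟_)
open import Data.Fin.Properties using (suc-injective; ¬∀⟶∃¬; all?)
open import Data.List using ([]; _∷_; foldr; tabulate)
open import Data.List.Properties using (map-tabulate; tabulate-cong)
open import Data.Nat using (zero; suc; _+_; _⊔_; z≤n; s≤s)
open import Data.Nat.ListAction using (sum)
open import Data.Nat.Properties
  using (≤-reflexive; ≤-trans; ≤-antisym; ⊔-sel; ⊔-identityʳ; ⊔-lub;
         m≤m⊔n; m≤n⊔m; <⇒≱; m≤n+o⇒m∸n≤o; +-commutativeSemigroup; module ≤-Reasoning)
open import Data.Product using (∃₂; _,_; proj₂)
open import Data.Sum using (_⊎_; inj₁; inj₂; [_,_]′)
open import Data.Unit using (tt)
open import Function using (_∘_; id)
open import Function.Definitions using (Injective)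
import Relation.Binary.PropositionalEquality as ≡
open ≡ using (refl; trans; cong; cong₂; _≢_; module ≡-Reasoning)
open import Relation.Nullary using (Dec; yes; no; contradiction)
open import Relation.Nullary.Decidable using (⌊_⌋; ⌊⌋-map′; _→-dec_)

indicator : Bool → ℕ
indicator b = if b then 1 else 0

count : ∀ {n} → (Fin n → Bool) → ℕ
count P = sum (tabulate (indicator ∘ P))

deg≡count : ∀ {n} (G : Graph n) v → deg G v ≡ count (adj G v)
deg≡count {n} G v = cong sum (map-tabulate {n = n} id (indicator ∘ adj G v))

count-cong : ∀ {n} {P Q : Fin n → Bool} → (∀ z → P z ≡ Q z) → count P ≡ count Q
count-cong P≗Q = cong sum (tabulate-cong (cong indicator ∘ P≗Q))

∧-not-elim : ∀ {A : Set} b (a? : Dec A) → b ∧ not ⌊ a? ⌋ ≡ true → b ≡ true × ¬ A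
∧-not-elim true (no ¬a) _ = refl , ¬a

_∖_ : ∀ {n} → (Fin n → Bool) → Fin n → Fin n → Bool
(P ∖ a) z = P z ∧ not ⌊ z ≟ a ⌋

∖-true : ∀ {n} {P : Fin n → Bool} {a z} → P z ≡ true → z ≢ a → (P ∖ a) z ≡ true
∖-true {a = a} {z} Pz z≢a with z ≟ a
... | yes z≡a = contradiction z≡a z≢a
... | no _ = cong (_∧ true) Pz

∖-suc : ∀ {n} (P : Fin (suc n) → Bool) a z → (P ∖ suc a) (suc z) ≡ ((P ∘ suc) ∖ a) z
∖-suc P a z = cong (λ b → P (suc z) ∧ not b) (⌊⌋-map′ (cong suc) suc-injective (z ≟ a))

count-∖ : ∀ {n} (P : Fin n → Bool) a → count P ≡ indicator (P a) + count (P ∖ a)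
count-∖ P zero = cong (indicator (P zero) +_) (≡.sym (cong₂ _+_
  (cong indicator (∧-zeroʳ (P zero))) (count-cong (∧-identityʳ ∘ P ∘ suc))))
count-∖ P (suc a) = begin
  indicator (P zero) + count (P ∘ suc)
    ≡⟨ cong (indicator (P zero) +_) (count-∖ (P ∘ suc) a) ⟩
  indicator (P zero) + (indicator (P (suc a)) + count ((P ∘ suc) ∖ a))
    ≡⟨ x∙yz≈y∙xz (indicator (P zero)) (indicator (P (suc a))) (count ((P ∘ suc) ∖ a)) ⟩
  indicator (P (suc a)) + (indicator (P zero) + count ((P ∘ suc) ∖ a))
    ≡⟨ cong₂ (λ b c → indicator (P (suc a)) + (indicator b + c))
         (∧-identityʳ (P zero)) (count-cong (∖-suc P a)) ⟨
  indicator (P (suc a)) + count (P ∖ suc a) ∎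
  where
  open ≡-Reasoning
  open import Algebra.Properties.CommutativeSemigroup +-commutativeSemigroup using (x∙yz≈y∙xz)

count-mono-injective : ∀ {m n} {P : Fin m → Bool} {Q : Fin n → Bool} {f : Fin m → Fin n} →
  Injective _≡_ _≡_ f → (∀ i → P i ≡ true → Q (f i) ≡ true) → count P ≤ count Q
count-mono-injective {zero} _ _ = z≤n
count-mono-injective {suc m} {P = P} {Q} {f} f-inj P⇒Qf with P zero in P₀
... | false = count-mono-injective (suc-injective ∘ f-inj) (P⇒Qf ∘ suc)
... | true = begin
  suc (count (P ∘ suc))   ≤⟨ s≤s (count-mono-injective (suc-injective ∘ f-inj) P⇒Q∖f₀) ⟩
  suc (count (Q ∖ f zero)) ≡⟨ cong (λ b → indicator b + count (Q ∖ f zero)) (P⇒Qf zero P₀) ⟨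
  indicator (Q (f zero)) + count (Q ∖ f zero) ≡⟨ count-∖ Q (f zero) ⟨
  count Q                 ∎
  where
  open ≤-Reasoning
  P⇒Q∖f₀ : ∀ i → P (suc i) ≡ true → (Q ∖ f zero) (f (suc i)) ≡ true
  P⇒Q∖f₀ i Pi = ∖-true {P = Q} (P⇒Qf (suc i) Pi) (λ fᵢ≡f₀ → contradiction (f-inj fᵢ≡f₀) λ ())

foldr-⊔-attained : ∀ {A : Set} (f : A → ℕ) x xs →
  ∃ λ w → foldr (λ w acc → f w ⊔ acc) 0 (x ∷ xs) ≡ f w
foldr-⊔-attained f x [] = x , ⊔-identityʳ (f x)
foldr-⊔-attained f x (y ∷ ys)
  with ⊔-sel (f x) (foldr (λ w acc → f w ⊔ acc) 0 (y ∷ ys)) | foldr-⊔-attained f y ys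
... | inj₁ max≡fx | _ = x , max≡fx
... | inj₂ max≡rest | w , rest≡fw = w , trans max≡rest rest≡fw

maxFin-attained : ∀ {n} (f : Fin n → ℕ) → Fin n → ∃ λ w → maxFin f ≡ f w
maxFin-attained {suc n} f _ = foldr-⊔-attained f zero (tabulate suc)

InN-cases : ∀ {m} (H : Graph m) {i j w} → InN H i j w ≡ true →
  (adj H i w ≡ true × w ≢ j) ⊎ (adj H j w ≡ true × w ≢ i)
InN-cases H {i} {j} {w} w∈N with adj H i w ∧ not ⌊ w ≟ j ⌋ in w∈Nᵢ
... | true = inj₁ (∧-not-elim (adj H i w) (w ≟ j) w∈Nᵢ)
... | false = inj₂ (∧-not-elim (adj H j w) (w ≟ i) w∈N)

¬isolated⇒InN : ∀ {m} (H : Graph m) {i j} → ¬ IsolatedEdge H i j → ∃ λ w → InN H i j w ≡ true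
¬isolated⇒InN {m} H {i} {j} ¬iso with w , w∉N ← ¬∀⟶∃¬ m _ (λ w → InN H i j w Bool.≟ false) ¬iso =
  w , ¬-not w∉N

wt₁-attained : ∀ {m} (H : Graph m) {i j} → ¬ IsolatedEdge H i j →
  ∃ λ w → InN H i j w ≡ true × wt₁ H i j ≤ deg H w
wt₁-attained H {i} {j} ¬iso
  with w₀ , w₀∈N ← ¬isolated⇒InN H ¬iso
  with w , wt₁≡ ← maxFin-attained (λ w → if InN H i j w then deg H w else 0) w₀
  with InN H i j w in w∈N
... | true = w , w∈N , ≤-reflexive wt₁≡
-- a maximiser outside N(ij) contributes 0, so wt₁ H i j = 0
... | false = w₀ , w₀∈N , ≤-trans (≤-reflexive wt₁≡) z≤n

adj⇒≢ : ∀ {m} (H : Graph m) {x w} → adj H x w ≡ true → w ≢ x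
adj⇒≢ H {x} xw∈H refl = contradiction (trans (≡.sym xw∈H) (irref H x)) λ ()

addEdge-cases : ∀ {n} (G : Graph n) {u v x y} → addEdge G u v x y ≡ true →
  adj G x y ≡ true ⊎ (x ≡ u × y ≡ v) ⊎ (x ≡ v × y ≡ u)
addEdge-cases G {u} {v} {x} {y} xy∈G+uv
  with adj G x y | x ≟ u | y ≟ v | x ≟ v | y ≟ u
... | true  | _       | _       | _       | _       = inj₁ refl
... | false | yes x≡u | yes y≡v | _       | _       = inj₂ (inj₁ (x≡u , y≡v))
... | false | _       | _       | yes x≡v | yes y≡u = inj₂ (inj₂ (x≡v , y≡u))
... | false | no _    | _       | no _    | _       = contradiction xy∈G+uv λ ()
... | false | no _    | _       | yes _   | no _    = contradiction xy∈G+uv λ ()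
... | false | yes _   | no _    | no _    | _       = contradiction xy∈G+uv λ ()
... | false | yes _   | no _    | yes _   | no _    = contradiction xy∈G+uv λ ()

addEdge⇒adj : ∀ {n} (G : Graph n) {u v x y} → addEdge G u v x y ≡ true →
  y ≢ u → y ≢ v → adj G x y ≡ true
addEdge⇒adj G xy∈G+uv y≢u y≢v with addEdge-cases G xy∈G+uv
... | inj₁ xy∈G = xy∈G
... | inj₂ (inj₁ (_ , y≡v)) = contradiction y≡v y≢v
... | inj₂ (inj₂ (_ , y≡u)) = contradiction y≡u y≢u

addEdge-comm : ∀ {n} (G : Graph n) u v x y → addEdge G u v x y ≡ addEdge G v u x y
addEdge-comm G u v x y =
  cong (adj G x y ∨_) (∨-comm (⌊ x ≟ u ⌋ ∧ ⌊ y ≟ v ⌋) (⌊ x ≟ v ⌋ ∧ ⌊ y ≟ u ⌋))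

record NewEdgeCopy {m n} (H : Graph m) (G : Graph n) (u v : Fin n) : Set where
  field
    f           : Fin m → Fin n
    f-injective : Injective _≡_ _≡_ f
    f-edge      : ∀ x y → adj H x y ≡ true → addEdge G u v (f x) (f y) ≡ true
    i j         : Fin m
    ij∈H        : adj H i j ≡ true
    fi≡u        : f i ≡ u
    fj≡v        : f j ≡ v

reverse : ∀ {m n} {H : Graph m} {G : Graph n} {u v} → NewEdgeCopy H G u v → NewEdgeCopy H G v u
reverse {H = H} {G} {u} {v} c = record
  { f           = f
  ; f-injective = f-injective
  ; f-edge      = λ x y xy∈H → trans (addEdge-comm G v u (f x) (f y)) (f-edge x y xy∈H)
  ; i           = j
  ; j           = i
  ; ij∈H        = trans (sym H j i) ij∈H
  ; fi≡u        = fj≡v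
  ; fj≡v        = fi≡u
  }
  where open NewEdgeCopy c

module _ {m n} {H : Graph m} {G : Graph n} {u v} (c : NewEdgeCopy H G u v) where
  open NewEdgeCopy c

  edge-away : ∀ {x w} → adj H x w ≡ true → w ≢ i → w ≢ j → adj G (f x) (f w) ≡ true
  edge-away xw∈H w≢i w≢j = addEdge⇒adj G (f-edge _ _ xw∈H)
    (λ fw≡u → w≢i (f-injective (trans fw≡u (≡.sym fi≡u))))
    (λ fw≡v → w≢j (f-injective (trans fw≡v (≡.sym fj≡v))))

  deg-away : ∀ {w} → w ≢ i → w ≢ j → deg H w ≤ deg G (f w)
  deg-away {w} w≢i w≢j = begin
    deg H w             ≡⟨ deg≡count H w ⟩
    count (adj H w)     ≤⟨ count-mono-injective f-injective fw∼fz ⟩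
    count (adj G (f w)) ≡⟨ deg≡count G (f w) ⟨
    deg G (f w)         ∎
    where
    open ≤-Reasoning
    fw∼fz : ∀ z → adj H w z ≡ true → adj G (f w) (f z) ≡ true
    fw∼fz z wz∈H = trans (sym G (f w) (f z)) (edge-away (trans (sym H z w) wz∈H) w≢i w≢j)

  u∼f : ∀ {w} → adj H i w ≡ true → w ≢ j → adj G u (f w) ≡ true
  u∼f iw∈H w≢j = ≡.subst (λ x → adj G x (f _) ≡ true) fi≡u (edge-away iw∈H (adj⇒≢ H iw∈H) w≢j)

  v∼f : ∀ {w} → adj H j w ≡ true → w ≢ i → adj G v (f w) ≡ true
  v∼f jw∈H w≢i = ≡.subst (λ x → adj G x (f _) ≡ true) fj≡v (edge-away jw∈H w≢i (adj⇒≢ H jw∈H))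

  deg-source : deg H i ≤ suc (deg G u)
  deg-source = begin
    deg H i                                       ≡⟨ deg≡count H i ⟩
    count (adj H i)                               ≡⟨ count-∖ (adj H i) j ⟩
    indicator (adj H i j) + count (adj H i ∖ j)   ≡⟨ cong (λ b → indicator b + count (adj H i ∖ j)) ij∈H ⟩
    suc (count (adj H i ∖ j))                     ≤⟨ s≤s (count-mono-injective f-injective u∼fz) ⟩
    suc (count (adj G u))                         ≡⟨ cong suc (deg≡count G u) ⟨
    suc (deg G u)                                 ∎
    where
    open ≤-Reasoning
    u∼fz : ∀ z → (adj H i ∖ j) z ≡ true → adj G u (f z) ≡ true
    u∼fz z iz∈H∖j = let iz∈H , z≢j = ∧-not-elim (adj H i z) (z ≟ j) iz∈H∖j in u∼f iz∈H z≢j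

  heavy-neighbour : ¬ IsolatedEdge H i j →
    ∃ λ y → (adj G u y ≡ true ⊎ adj G v y ≡ true) × wt₁ H i j ≤ deg G y
  heavy-neighbour ¬iso with w , w∈N , wt₁≤deg ← wt₁-attained H ¬iso with InN-cases H w∈N
  ... | inj₁ (iw∈H , w≢j) =
    f w , inj₁ (u∼f iw∈H w≢j) , ≤-trans wt₁≤deg (deg-away (adj⇒≢ H iw∈H) w≢j)
  ... | inj₂ (jw∈H , w≢i) =
    f w , inj₂ (v∼f jw∈H w≢i) , ≤-trans wt₁≤deg (deg-away w≢i (adj⇒≢ H jw∈H))

wt₀-bound : ∀ {m n} {H : Graph m} {G : Graph n} {u v} (c : NewEdgeCopy H G u v) →
  let open NewEdgeCopy c in wt₀ H i j ≤ deg G u ⊔ deg G v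
wt₀-bound {G = G} {u} {v} c = m≤n+o⇒m∸n≤o _ 1 (⊔-lub
  (≤-trans (deg-source c) (s≤s (m≤m⊔n (deg G u) (deg G v))))
  (≤-trans (deg-source (reverse c)) (s≤s (m≤n⊔m (deg G u) (deg G v)))))

¬-implication : ∀ {b c} → ¬ (b ≡ true → c ≡ true) → b ≡ true × c ≡ false
¬-implication {true}  {false} _ = refl , refl
¬-implication {true}  {true}  ¬b⇒c = contradiction (λ _ → refl) ¬b⇒c
¬-implication {false}         ¬b⇒c = contradiction (λ ()) ¬b⇒c

¬∀₂⟶∃₂¬ : ∀ {m n} (P : Fin m → Fin n → Set) → (∀ x y → Dec (P x y)) →
  ¬ (∀ x y → P x y) → ∃₂ λ x y → ¬ P x y
¬∀₂⟶∃₂¬ {m} {n} P P? ¬∀P =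
  let x , ¬∀Pₓ = ¬∀⟶∃¬ m _ (λ x → all? (P? x)) ¬∀P
      y , ¬Pₓᵧ = ¬∀⟶∃¬ n _ (P? x) ¬∀Pₓ
  in x , y , ¬Pₓᵧ

missing-edge : ∀ {m n} (H : Graph m) (A : Fin n → Fin n → Bool) (f : Fin m → Fin n) →
  ¬ (∀ x y → adj H x y ≡ true → A (f x) (f y) ≡ true) →
  ∃₂ λ x y → adj H x y ≡ true × A (f x) (f y) ≡ false
missing-edge H A f ¬hom =
  let x , y , ¬hom-xy = ¬∀₂⟶∃₂¬ _ (λ x y → (adj H x y Bool.≟ true) →-dec (A (f x) (f y) Bool.≟ true)) ¬hom
  in x , y , ¬-implication ¬hom-xy

saturated-nonedge : ∀ {m n} {H : Graph m} {G : Graph n} {u v} → Saturated H G →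
  u ≢ v → adj G u v ≡ false → NewEdgeCopy H G u v
saturated-nonedge {H = H} {G} (H⊈G , saturating) u≢v uv∉G
  with f , f-inj , f-edge ← saturating _ _ u≢v uv∉G
  with x , y , xy∈H , fxfy∉G ← missing-edge H (adj G) f (λ hom → H⊈G (f , f-inj , hom))
  with addEdge-cases G (f-edge x y xy∈H)
... | inj₁ fxfy∈G = contradiction (trans (≡.sym fxfy∉G) fxfy∈G) λ ()
... | inj₂ (inj₁ (fx≡u , fy≡v)) = record
  { f = f ; f-injective = f-inj ; f-edge = f-edge
  ; i = x ; j = y ; ij∈H = xy∈H ; fi≡u = fx≡u ; fj≡v = fy≡v }
... | inj₂ (inj₂ (fx≡v , fy≡u)) = record
  { f = f ; f-injective = f-inj ; f-edge = f-edge
  ; i = y ; j = x ; ij∈H = trans (sym H y x) xy∈H ; fi≡u = fy≡u ; fj≡v = fx≡v }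

saturated-light-clique : ∀ {m n} (H : Graph m) (G : Graph n) → Saturated H G →
  (∀ i j → IsEdge H i j → ¬ IsolatedEdge H i j) → (K : ℕ) (S : Fin n → Set) →
  (∀ {x} → S x → ∀ y → adj G x y ≡ true → deg G y < K) →
  (∀ {u v} (c : NewEdgeCopy H G u v) → S u → S v → K ≤ wt₁ H (NewEdgeCopy.i c) (NewEdgeCopy.j c)) →
  IsClique G S
saturated-light-clique H G sat no-isolated K S light K≤wt₁ u v Su Sv u≢v with adj G u v in uv∉G
... | true = refl
... | false =
  let c = saturated-nonedge sat u≢v uv∉G
      open NewEdgeCopy c
      y , y∼uv , wt₁≤y = heavy-neighbour c (no-isolated i j ij∈H)
  in contradiction (≤-trans (K≤wt₁ c Su Sv) wt₁≤y) (<⇒≱ ([ light Su y , light Sv y ]′ y∼uv))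

proposition2p2 : ∀ {m n} (H : Graph m) (G : Graph n) (k₀ k₁ k₁′ : ℕ) →
    (∃ λ u → ∃ λ v → IsEdge H u v) →
    (∀ u v → IsEdge H u v → ¬ IsolatedEdge H u v) →
    IsMinOverEdges H (λ _ _ → ⊤) (wt₀ H) k₀ →
    IsMinOverEdges H (λ _ _ → ⊤) (wt₁ H) k₁ →
    IsMinOverEdges H (λ u v → wt₀ H u v ≡ k₀) (wt₁ H) k₁′ →
    Saturated H G →
    IsClique G (λ x → ∀ y → adj G x y ≡ true → deg G y < k₁) ×
    IsClique G (λ x → deg G x ≤ k₀ × (∀ y → adj G x y ≡ true → deg G y < k₁′))
proposition2p2 H G k₀ k₁ k₁′ _ no-isolated (_ , k₀≤wt₀) (_ , k₁≤wt₁) (_ , k₁′≤wt₁) sat =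
    saturated-light-clique H G sat no-isolated k₁ _ id
      (λ c _ _ → k₁≤wt₁ _ _ (ij∈H c) tt)
  , saturated-light-clique H G sat no-isolated k₁′ _ proj₂
      (λ c (du , _) (dv , _) → k₁′≤wt₁ _ _ (ij∈H c) (wt₀≡k₀ c du dv))
  where
  open NewEdgeCopy
  wt₀≡k₀ : ∀ {u v} (c : NewEdgeCopy H G u v) → deg G u ≤ k₀ → deg G v ≤ k₀ → wt₀ H (i c) (j c) ≡ k₀
  wt₀≡k₀ c du dv = ≤-antisym (≤-trans (wt₀-bound c) (⊔-lub du dv)) (k₀≤wt₀ _ _ (ij∈H c) tt)
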